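{- Let $G$ be a finite simple graph with a $1$-factor $F$, and let $\mathcal{C}=\{C_1,\ldots,C_k\}$ be a zero-sum $F$-set of $G$. Let $\vec{G}$ be an orientation of $G$ in which $C_1,\ldots,C_{k_1}$ are oddly oriented and $C_{k_1+1},\ldots,C_k$ are evenly oriented, where $0\le k_1\le k$, and put $k_2:=k-k_1$. Then: if $k_1$ is odd, $G$ has no even $F$-orientation; and if $k_2$ is odd, $G$ has no odd $F$-orientation.
   Context: A cycle $C$ of $G$ is $F$-alternating if $|E(C)|=2|E(F)\cap E(C)|$ (so its edges alternate between $F$ and non-$F$ edges). An even cycle $C$ in an orientation of $G$ is evenly (resp. oddly) oriented if, for either direction of traversal around $C$, the number of edges of $C$ directed along the traversal is even (resp. odd). An orientation of $G$ is an even (resp. odd) $F$-orientation if every $F$-alternating cycle is evenly (resp. oddly) oriented. A zero-sum $F$-set is a finite family $\{C_1,\ldots,C_k\}$ of $F$-alternating cycles such that every edge of $G$ lies in an even number of its members. -}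

module Defs where

open import Data.Nat using (ℕ; zero; suc; _+_; _*_; _<_; _≤_; _<?_)
open import Data.Nat.Divisibility using (_∣_)
open import Data.Fin using (Fin; zero; suc; toℕ; fromℕ<) renaming (_≟_ to _≟ᶠ_)
open import Data.Bool using (Bool; true; false; _∧_; _∨_; not)
open import Data.Product using (Σ; _×_; _,_)
open import Relation.Nullary using (¬_; yes; no)
open import Relation.Nullary.Decidable using (⌊_⌋)
open import Relation.Binary.PropositionalEquality using (_≡_)

count : ∀ {m} → (Fin m → Bool) → ℕ
count {zero}  p = 0
count {suc m} p = (if? (p zero)) + count (λ i → p (suc i))
  where
  if? : Bool → ℕ
  if? true  = 1
  if? false = 0

anyF : ∀ {m} → (Fin m → Bool) → Bool
anyF {zero}  p = false
anyF {suc m} p = p zero ∨ anyF (λ i → p (suc i))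

Even : ℕ → Set
Even n = 2 ∣ n

Odd : ℕ → Set
Odd n = ¬ (2 ∣ n)

next : ∀ {m} → Fin (suc m) → Fin (suc m)
next {m} i with toℕ i <? m
... | yes p = suc (fromℕ< p)
... | no _  = zero

record SimpleGraph (n : ℕ) : Set where
  field
    adj     : Fin n → Fin n → Bool
    adj-sym : ∀ u v → adj u v ≡ adj v u
    irrefl  : ∀ u → adj u u ≡ false
open SimpleGraph public

record OneFactor {n : ℕ} (G : SimpleGraph n) : Set where
  field
    fe     : Fin n → Fin n → Bool
    fe-sym : ∀ u v → fe u v ≡ fe v u
    fe-sub : ∀ u v → fe u v ≡ true → adj G u v ≡ true
    fe-one : ∀ u → count (fe u) ≡ 1
open OneFactor public

-- a cycle of G of length m = 3 + l, given by a cyclic sequence of distinct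
-- vertices v₀, …, v_{m-1} with v_i v_{i+1} ∈ E(G) (indices mod m)
record Cycle {n : ℕ} (G : SimpleGraph n) : Set where
  field
    len-3 : ℕ
    vx    : Fin (suc (suc (suc len-3))) → Fin n
    vx-inj : ∀ i j → vx i ≡ vx j → i ≡ j
    vx-adj : ∀ i → adj G (vx i) (vx (next i)) ≡ true
open Cycle public

cLen : ∀ {n} {G : SimpleGraph n} → Cycle G → ℕ
cLen C = suc (suc (suc (len-3 C)))

edgeIn : ∀ {n} {G : SimpleGraph n} → Cycle G → Fin n → Fin n → Bool
edgeIn C u v = anyF (λ i →
  (⌊ vx C i ≟ᶠ u ⌋ ∧ ⌊ vx C (next i) ≟ᶠ v ⌋) ∨
  (⌊ vx C i ≟ᶠ v ⌋ ∧ ⌊ vx C (next i) ≟ᶠ u ⌋))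

-- |E(F) ∩ E(C)|  (the edges v_i v_{i+1} of C are pairwise distinct)
fInC : ∀ {n} {G : SimpleGraph n} → OneFactor G → Cycle G → ℕ
fInC F C = count (λ i → fe F (vx C i) (vx C (next i)))

Alternating : ∀ {n} {G : SimpleGraph n} → OneFactor G → Cycle G → Set
Alternating F C = cLen C ≡ 2 * fInC F C

ZeroSumFSet : ∀ {n} {G : SimpleGraph n} → OneFactor G → (k : ℕ) → (Fin k → Cycle G) → Set
ZeroSumFSet {G = G} F k C =
  (∀ i → Alternating F (C i)) ×
  (∀ u v → adj G u v ≡ true → Even (count (λ i → edgeIn (C i) u v)))

record Orientation {n : ℕ} (G : SimpleGraph n) : Set where
  field
    dir     : Fin n → Fin n → Bool
    dir-sub : ∀ u v → dir u v ≡ true → adj G u v ≡ true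
    dir-one : ∀ u v → adj G u v ≡ true → dir v u ≡ not (dir u v)
open Orientation public

forwardCount : ∀ {n} {G : SimpleGraph n} → Orientation G → Cycle G → ℕ
forwardCount D C = count (λ i → dir D (vx C i) (vx C (next i)))

EvenlyOriented : ∀ {n} {G : SimpleGraph n} → Orientation G → Cycle G → Set
EvenlyOriented D C = Even (forwardCount D C)

OddlyOriented : ∀ {n} {G : SimpleGraph n} → Orientation G → Cycle G → Set
OddlyOriented D C = Odd (forwardCount D C)

EvenFOrientation : ∀ {n} {G : SimpleGraph n} → OneFactor G → Orientation G → Set
EvenFOrientation F D = ∀ C → Alternating F C → EvenlyOriented D C

OddFOrientation : ∀ {n} {G : SimpleGraph n} → OneFactor G → Orientation G → Set
OddFOrientation F D = ∀ C → Alternating F C → OddlyOriented D C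

-- Work over GF(2). For two orientations D, D′ of G, the parities of the numbers of
-- forward edges of a cycle C under D and under D′ differ by the parity of the number
-- of edges of C on which D and D′ disagree. Summing over a zero-sum F-set, every edge
-- is counted an even number of times, so the parities differ on an even number of
-- the Cᵢ. If D′ were an even (odd) F-orientation, they would differ exactly on the
-- k₁ oddly (k₂ evenly) oriented cycles, forcing k₁ (k₂) to be even.
module Submission where

open import Defs
open import Data.Nat using (ℕ; _≤_; _<_; _≥_; _∸_)
open import Data.Fin using (Fin; toℕ)
open import Data.Product using (Σ; _×_)
open import Relation.Nullary using (¬_)

open import Algebra.Bundles using (CommutativeRing)
open import Data.Bool using (Bool; true; false; not; _∧_; _∨_; _xor_)
open import Data.Bool.Properties
  using (xor-∧-commutativeRing; xor-is-ok; xor-same; xor-identityʳ; xor-annihilates-not;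
         ∧-identityʳ; ∧-comm; ∧-assoc; not-involutive; ¬-not; ∧-conicalˡ; ∧-conicalʳ)
open import Data.Empty using (⊥; ⊥-elim)
open import Data.Fin using (zero; suc; _≟_)
open import Data.Fin.Properties using (suc-injective; toℕ-fromℕ<; toℕ≤pred[n])
open import Data.Nat using (zero; suc; _+_; _*_; pred; z≤n; s≤s; _<?_)
open import Data.Nat.Divisibility using (divides)
open import Data.Nat.Properties using (≤-antisym; ≮⇒≥; m≢1+n+m; 1+n≢0)
open import Data.Product using (_,_)
open import Data.Sum using (_⊎_; inj₁; inj₂)
open import Function using (_∘_; case_of_)
open import Relation.Nullary using (yes; no)
open import Relation.Nullary.Decidable using (⌊_⌋; ⌊⌋-map′)
open import Relation.Binary.PropositionalEquality

open CommutativeRing xor-∧-commutativeRing using (semiring; +-group)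
open import Algebra.Properties.Semiring.Sum semiring
  using (sum; sum-syntax; sum-cong-≗; sum-replicate-zero; ∑-distrib-+; ∑-comm; *-distribˡ-sum)
open import Algebra.Properties.Group +-group using (x∙y⁻¹≈ε⇒x≈y)

-- Sums in GF(2) = (Bool, xor, ∧)

∑-false : ∀ {m} {f : Fin m → Bool} → (∀ i → f i ≡ false) → sum f ≡ false
∑-false {m} f≡false = trans (sum-cong-≗ f≡false) (sum-replicate-zero m)

∑-select : ∀ {m} (a : Fin m) (g : Fin m → Bool) → ∑[ u < m ] (⌊ a ≟ u ⌋ ∧ g u) ≡ g a
∑-select zero    g =
  trans (cong (g zero xor_) (∑-false {f = λ u → ⌊ zero ≟ suc u ⌋ ∧ g (suc u)} λ _ → refl))
        (xor-identityʳ (g zero))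
∑-select (suc a) g =
  trans (sum-cong-≗ λ u → cong (_∧ g (suc u)) (⌊⌋-map′ (cong suc) suc-injective (a ≟ u)))
        (∑-select a (g ∘ suc))

∑∑-symmetric≡false : ∀ {m} (g : Fin m → Fin m → Bool) →
  (∀ u v → g u v ≡ g v u) → (∀ u → g u u ≡ false) → ∑[ u < m ] ∑[ v < m ] g u v ≡ false
∑∑-symmetric≡false {zero}  g sym-g diag-g = refl
∑∑-symmetric≡false {suc m} g sym-g diag-g = begin
  (g zero zero xor row) xor ∑[ u < m ] (g (suc u) zero xor rest u)
    ≡⟨ cong₂ (λ d s → (d xor row) xor s) (diag-g zero) (∑-distrib-+ (λ u → g (suc u) zero) rest) ⟩
  row xor (∑[ u < m ] g (suc u) zero xor ∑[ u < m ] rest u)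
    ≡⟨ cong₂ (λ c r → row xor (c xor r))
             (sum-cong-≗ λ u → sym-g (suc u) zero)
             (∑∑-symmetric≡false (λ u v → g (suc u) (suc v))
                                 (λ u v → sym-g (suc u) (suc v)) (diag-g ∘ suc)) ⟩
  row xor (row xor false)
    ≡⟨ trans (cong (row xor_) (xor-identityʳ row)) (xor-same row) ⟩
  false ∎
  where
  open ≡-Reasoning
  row : Bool
  row = ∑[ v < m ] g zero (suc v)
  rest : Fin m → Bool
  rest u = ∑[ v < m ] g (suc u) (suc v)

∑-reindex₂ : ∀ {m n} (a b : Fin m → Fin n) (x : Fin n → Fin n → Bool) →
  ∑[ i < m ] x (a i) (b i) ≡ ∑[ u < n ] ∑[ v < n ] (x u v ∧ ∑[ i < m ] (⌊ a i ≟ u ⌋ ∧ ⌊ b i ≟ v ⌋))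
∑-reindex₂ {m} {n} a b x = sym (begin
  ∑[ u < n ] ∑[ v < n ] (x u v ∧ ∑[ i < m ] (⌊ a i ≟ u ⌋ ∧ ⌊ b i ≟ v ⌋))
    ≡⟨ sum-cong-≗ (λ u → sum-cong-≗ λ v → *-distribˡ-sum (x u v) (λ i → ⌊ a i ≟ u ⌋ ∧ ⌊ b i ≟ v ⌋)) ⟩
  ∑[ u < n ] ∑[ v < n ] ∑[ i < m ] term i u v
    ≡⟨ sum-cong-≗ (λ u → ∑-comm (λ v i → term i u v)) ⟩
  ∑[ u < n ] ∑[ i < m ] ∑[ v < n ] term i u v
    ≡⟨ ∑-comm (λ u i → ∑[ v < n ] term i u v) ⟩
  ∑[ i < m ] ∑[ u < n ] ∑[ v < n ] term i u v
    ≡⟨ sum-cong-≗ (λ i → sum-cong-≗ λ u → sum-cong-≗ λ v → regroup (x u v) ⌊ a i ≟ u ⌋ ⌊ b i ≟ v ⌋) ⟩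
  ∑[ i < m ] ∑[ u < n ] ∑[ v < n ] (⌊ a i ≟ u ⌋ ∧ (⌊ b i ≟ v ⌋ ∧ x u v))
    ≡⟨ sum-cong-≗ (λ i → sum-cong-≗ λ u → sym (*-distribˡ-sum ⌊ a i ≟ u ⌋ (λ v → ⌊ b i ≟ v ⌋ ∧ x u v))) ⟩
  ∑[ i < m ] ∑[ u < n ] (⌊ a i ≟ u ⌋ ∧ ∑[ v < n ] (⌊ b i ≟ v ⌋ ∧ x u v))
    ≡⟨ sum-cong-≗ (λ i → sum-cong-≗ λ u → cong (⌊ a i ≟ u ⌋ ∧_) (∑-select (b i) (x u))) ⟩
  ∑[ i < m ] ∑[ u < n ] (⌊ a i ≟ u ⌋ ∧ x u (b i))
    ≡⟨ sum-cong-≗ (λ i → ∑-select (a i) (λ u → x u (b i))) ⟩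
  ∑[ i < m ] x (a i) (b i) ∎)
  where
  open ≡-Reasoning
  term : Fin m → Fin n → Fin n → Bool
  term i u v = x u v ∧ (⌊ a i ≟ u ⌋ ∧ ⌊ b i ≟ v ⌋)
  regroup : ∀ p q r → p ∧ (q ∧ r) ≡ q ∧ (r ∧ p)
  regroup p q r = trans (∧-comm p (q ∧ r)) (∧-assoc q r p)

anyF≡∑ : ∀ {m} (h : Fin m → Bool) → (∀ i j → h i ≡ true → h j ≡ true → i ≡ j) → anyF h ≡ sum h
anyF≡∑ {zero}  h unique = refl
anyF≡∑ {suc m} h unique with h zero in h₀
... | true  = sym (cong not (∑-false rest-false))
  where
  rest-false : ∀ i → h (suc i) ≡ false
  rest-false i = ¬-not λ hᵢ → case unique zero (suc i) h₀ hᵢ of λ ()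
... | false = anyF≡∑ (h ∘ suc) (λ i j hᵢ hⱼ → suc-injective (unique (suc i) (suc j) hᵢ hⱼ))

∨≡xor : ∀ a b → a ∧ b ≡ false → a ∨ b ≡ a xor b
∨≡xor a b a∧b≡false =
  sym (trans (xor-is-ok a b) (trans (cong (λ c → (a ∨ b) ∧ not c) a∧b≡false) (∧-identityʳ (a ∨ b))))

xor≡false⇒≡ : ∀ {a b} → a xor b ≡ false → a ≡ b
xor≡false⇒≡ {a} {b} = x∙y⁻¹≈ε⇒x≈y a b

isOdd : ℕ → Bool
isOdd zero    = false
isOdd (suc n) = not (isOdd n)

isOdd-count : ∀ {m} (p : Fin m → Bool) → isOdd (count p) ≡ sum p
isOdd-count {zero}  p = refl
isOdd-count {suc m} p with p zero
... | true  = cong not (isOdd-count (p ∘ suc))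
... | false = isOdd-count (p ∘ suc)

Even⇒isOdd≡false : ∀ {n} → Even n → isOdd n ≡ false
Even⇒isOdd≡false (divides q refl) = isOdd-double q
  where
  isOdd-double : ∀ q → isOdd (q * 2) ≡ false
  isOdd-double zero    = refl
  isOdd-double (suc q) = trans (not-involutive _) (isOdd-double q)

isOdd≡false⇒Even : ∀ n → isOdd n ≡ false → Even n
isOdd≡false⇒Even zero          _ = divides 0 refl
isOdd≡false⇒Even (suc (suc n)) p with isOdd≡false⇒Even n (trans (sym (not-involutive _)) p)
... | divides q refl = divides (suc q) refl

Odd⇒isOdd≡true : ∀ {n} → Odd n → isOdd n ≡ true
Odd⇒isOdd≡true {n} odd = ¬-not (odd ∘ isOdd≡false⇒Even n)

∑-trueBelow : ∀ {k k₁} → k₁ ≤ k → (f : Fin k → Bool) →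
  (∀ c → toℕ c < k₁ → f c ≡ true) → (∀ c → toℕ c ≥ k₁ → f c ≡ false) → sum f ≡ isOdd k₁
∑-trueBelow {k₁ = zero} _ f below above = ∑-false (λ c → above c z≤n)
∑-trueBelow {suc k} {suc j} (s≤s j≤k) f below above =
  cong₂ _xor_ (below zero (s≤s z≤n))
    (∑-trueBelow j≤k (f ∘ suc) (λ c → below (suc c) ∘ s≤s) (λ c → above (suc c) ∘ s≤s))

∑-trueAbove : ∀ {k k₁} → k₁ ≤ k → (f : Fin k → Bool) →
  (∀ c → toℕ c < k₁ → f c ≡ false) → (∀ c → toℕ c ≥ k₁ → f c ≡ true) → sum f ≡ isOdd (k ∸ k₁)
∑-trueAbove {zero}  {zero}  _ f below above = refl
∑-trueAbove {suc k} {zero}  _ f below above =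
  cong₂ _xor_ (above zero z≤n) (∑-trueAbove z≤n (f ∘ suc) (λ _ ()) (λ c _ → above (suc c) z≤n))
∑-trueAbove {suc k} {suc j} (s≤s j≤k) f below above =
  cong₂ _xor_ (below zero (s≤s z≤n))
    (∑-trueAbove j≤k (f ∘ suc) (λ c → below (suc c) ∘ s≤s) (λ c → above (suc c) ∘ s≤s))

toℕ-next : ∀ {m} (i : Fin (suc m)) → toℕ (next i) ≡ suc (toℕ i) ⊎ (toℕ i ≡ m × toℕ (next i) ≡ 0)
toℕ-next {m} i with toℕ i <? m
... | yes i<m = inj₁ (cong suc (toℕ-fromℕ< i<m))
... | no  i≮m = inj₂ (≤-antisym (toℕ≤pred[n] i) (≮⇒≥ i≮m) , refl)

next∘next≢id : ∀ {l} (i : Fin (3 + l)) → next (next i) ≢ i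
next∘next≢id i e with toℕ-next i | toℕ-next (next i)
... | inj₁ p       | inj₁ q       = m≢1+n+m (toℕ i) (trans (sym (cong toℕ e)) (trans q (cong suc p)))
... | inj₁ p       | inj₂ (q , r) = 1+n≢0 (cong pred (trans (sym q) (trans p (cong suc (trans (sym (cong toℕ e)) r)))))
... | inj₂ (p , q) | inj₁ r       = 1+n≢0 (cong pred (trans (sym p) (trans (sym (cong toℕ e)) (trans r (cong suc q)))))
... | inj₂ (_ , q) | inj₂ (r , _) = 1+n≢0 (trans (sym r) q)

module _ {n : ℕ} {G : SimpleGraph n} where

  isArc : (C : Cycle G) → Fin n → Fin n → Fin (cLen C) → Bool
  isArc C u v i = ⌊ vx C i ≟ u ⌋ ∧ ⌊ vx C (next i) ≟ v ⌋

  isArc-sound : ∀ (C : Cycle G) u v i → isArc C u v i ≡ true → vx C i ≡ u × vx C (next i) ≡ v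
  isArc-sound C u v i p with vx C i ≟ u | vx C (next i) ≟ v
  isArc-sound C u v i p  | yes vᵢ≡u | yes vᵢ₊₁≡v = vᵢ≡u , vᵢ₊₁≡v
  isArc-sound C u v i () | yes _    | no _
  isArc-sound C u v i () | no _     | _

  arcs : Cycle G → Fin n → Fin n → Bool
  arcs C u v = ∑[ i < cLen C ] isArc C u v i

  isArc-disjoint : ∀ (C : Cycle G) {u v} → u ≢ v → ∀ i → isArc C u v i ∧ isArc C v u i ≡ false
  isArc-disjoint C {u} {v} u≢v i = ¬-not λ both →
    let (uv , _) = isArc-sound C u v i (∧-conicalˡ (isArc C u v i) (isArc C v u i) both)
        (vu , _) = isArc-sound C v u i (∧-conicalʳ (isArc C u v i) (isArc C v u i) both)
    in u≢v (trans (sym uv) vu)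

  isArc∨-sound : ∀ (C : Cycle G) u v i → isArc C u v i ∨ isArc C v u i ≡ true →
    (vx C i ≡ u × vx C (next i) ≡ v) ⊎ (vx C i ≡ v × vx C (next i) ≡ u)
  isArc∨-sound C u v i e with isArc C u v i in a
  ... | true  = inj₁ (isArc-sound C u v i a)
  ... | false = inj₂ (isArc-sound C v u i e)

  -- i ≡ next j and next i ≡ j would give next (next j) ≡ j, impossible as cycles have length ≥ 3
  reversed-arc : ∀ (C : Cycle G) i j → vx C i ≡ vx C (next j) → vx C (next i) ≡ vx C j → ⊥
  reversed-arc C i j p q =
    next∘next≢id j (trans (cong next (sym (vx-inj C i (next j) p))) (vx-inj C (next i) j q))

  edge-traversed-once : ∀ (C : Cycle G) u v i j →
    isArc C u v i ∨ isArc C v u i ≡ true → isArc C u v j ∨ isArc C v u j ≡ true → i ≡ j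
  edge-traversed-once C u v i j eᵢ eⱼ with isArc∨-sound C u v i eᵢ | isArc∨-sound C u v j eⱼ
  ... | inj₁ (p , _)  | inj₁ (q , _)  = vx-inj C i j (trans p (sym q))
  ... | inj₂ (p , _)  | inj₂ (q , _)  = vx-inj C i j (trans p (sym q))
  ... | inj₁ (p , p′) | inj₂ (q , q′) = ⊥-elim (reversed-arc C i j (trans p (sym q′)) (trans p′ (sym q)))
  ... | inj₂ (p , p′) | inj₁ (q , q′) = ⊥-elim (reversed-arc C i j (trans p (sym q′)) (trans p′ (sym q)))

  edgeIn≡arcs-xor : ∀ (C : Cycle G) {u v} → u ≢ v → edgeIn C u v ≡ arcs C u v xor arcs C v u
  edgeIn≡arcs-xor C {u} {v} u≢v = begin
    anyF (λ i → isArc C u v i ∨ isArc C v u i)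
      ≡⟨ anyF≡∑ _ (edge-traversed-once C u v) ⟩
    ∑[ i < cLen C ] (isArc C u v i ∨ isArc C v u i)
      ≡⟨ sum-cong-≗ (λ i → ∨≡xor (isArc C u v i) (isArc C v u i) (isArc-disjoint C u≢v i)) ⟩
    ∑[ i < cLen C ] (isArc C u v i xor isArc C v u i)
      ≡⟨ ∑-distrib-+ (isArc C u v) (isArc C v u) ⟩
    arcs C u v xor arcs C v u ∎
    where open ≡-Reasoning

  alongCycle : Cycle G → (Fin n → Fin n → Bool) → Bool
  alongCycle C x = ∑[ i < cLen C ] x (vx C i) (vx C (next i))

  alongCycle≡∑∑-arcs : ∀ (C : Cycle G) x → alongCycle C x ≡ ∑[ u < n ] ∑[ v < n ] (x u v ∧ arcs C u v)
  alongCycle≡∑∑-arcs C = ∑-reindex₂ (vx C) (vx C ∘ next)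

  CoversEdgesEvenly : ∀ {k} → (Fin k → Cycle G) → Set
  CoversEdgesEvenly C = ∀ u v → adj G u v ≡ true → Even (count (λ c → edgeIn (C c) u v))

  -- Q u v counts the arcs u → v over the whole family. The even cover makes Q symmetric on
  -- edges, so x ∧ Q is a symmetric matrix with zero diagonal, whose entries cancel in pairs.
  ∑-alongCycle≡false : ∀ {k} (C : Fin k → Cycle G) → CoversEdgesEvenly C →
    (x : Fin n → Fin n → Bool) → (∀ u v → x u v ≡ x v u) → (∀ u v → x u v ≡ true → adj G u v ≡ true) →
    ∑[ c < k ] alongCycle (C c) x ≡ false
  ∑-alongCycle≡false {k} C cover x x-sym x⊆adj = begin
    ∑[ c < k ] alongCycle (C c) x
      ≡⟨ sum-cong-≗ (λ c → alongCycle≡∑∑-arcs (C c) x) ⟩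
    ∑[ c < k ] ∑[ u < n ] ∑[ v < n ] (x u v ∧ arcs (C c) u v)
      ≡⟨ ∑-comm (λ c u → ∑[ v < n ] (x u v ∧ arcs (C c) u v)) ⟩
    ∑[ u < n ] ∑[ c < k ] ∑[ v < n ] (x u v ∧ arcs (C c) u v)
      ≡⟨ sum-cong-≗ (λ u → ∑-comm (λ c v → x u v ∧ arcs (C c) u v)) ⟩
    ∑[ u < n ] ∑[ v < n ] ∑[ c < k ] (x u v ∧ arcs (C c) u v)
      ≡⟨ sum-cong-≗ (λ u → sum-cong-≗ λ v → *-distribˡ-sum (x u v) (λ c → arcs (C c) u v)) ⟨
    ∑[ u < n ] ∑[ v < n ] (x u v ∧ Q u v)
      ≡⟨ ∑∑-symmetric≡false (λ u v → x u v ∧ Q u v) x∧Q-sym x∧Q-diag ⟩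
    false ∎
    where
    open ≡-Reasoning
    Q : Fin n → Fin n → Bool
    Q u v = ∑[ c < k ] arcs (C c) u v

    Q-sym : ∀ u v → adj G u v ≡ true → Q u v ≡ Q v u
    Q-sym u v uv = xor≡false⇒≡ (begin
      Q u v xor Q v u
        ≡⟨ ∑-distrib-+ (λ c → arcs (C c) u v) (λ c → arcs (C c) v u) ⟨
      ∑[ c < k ] (arcs (C c) u v xor arcs (C c) v u)
        ≡⟨ sum-cong-≗ (λ c → edgeIn≡arcs-xor (C c) u≢v) ⟨
      ∑[ c < k ] edgeIn (C c) u v
        ≡⟨ isOdd-count (λ c → edgeIn (C c) u v) ⟨
      isOdd (count (λ c → edgeIn (C c) u v))
        ≡⟨ Even⇒isOdd≡false (cover u v uv) ⟩
      false ∎)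
      where
      u≢v : u ≢ v
      u≢v refl = case trans (sym (irrefl G u)) uv of λ ()

    x∧Q-sym : ∀ u v → x u v ∧ Q u v ≡ x v u ∧ Q v u
    x∧Q-sym u v with x u v in xuv
    ... | true  = trans (Q-sym u v (x⊆adj u v xuv)) (cong (_∧ Q v u) (trans (sym xuv) (x-sym u v)))
    ... | false = cong (_∧ Q v u) (trans (sym xuv) (x-sym u v))

    x∧Q-diag : ∀ u → x u u ∧ Q u u ≡ false
    x∧Q-diag u = cong (_∧ Q u u) (¬-not λ xuu → case trans (sym (irrefl G u)) (x⊆adj u u xuu) of λ ())

  dir-nonadj : ∀ (D : Orientation G) u v → adj G u v ≡ false → dir D u v ≡ false
  dir-nonadj D u v ¬uv = ¬-not λ d → case trans (sym ¬uv) (dir-sub D u v d) of λ ()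

  disagreement : Orientation G → Orientation G → Fin n → Fin n → Bool
  disagreement D D′ u v = dir D u v xor dir D′ u v

  disagreement-sym : ∀ D D′ u v → disagreement D D′ u v ≡ disagreement D D′ v u
  disagreement-sym D D′ u v with adj G u v in uv
  ... | true  = sym (trans (cong₂ _xor_ (dir-one D u v uv) (dir-one D′ u v uv))
                           (xor-annihilates-not (dir D u v) (dir D′ u v)))
  ... | false = trans (cong₂ _xor_ (dir-nonadj D u v uv) (dir-nonadj D′ u v uv))
                      (sym (cong₂ _xor_ (dir-nonadj D v u vu) (dir-nonadj D′ v u vu)))
    where
    vu : adj G v u ≡ false
    vu = trans (adj-sym G v u) uv

  disagreement⊆adj : ∀ D D′ u v → disagreement D D′ u v ≡ true → adj G u v ≡ true
  disagreement⊆adj D D′ u v d with adj G u v in uv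
  ... | true  = refl
  ... | false = trans (sym (cong₂ _xor_ (dir-nonadj D u v uv) (dir-nonadj D′ u v uv))) d

  isOdd-forwardCount : ∀ (D : Orientation G) (C : Cycle G) → isOdd (forwardCount D C) ≡ alongCycle C (dir D)
  isOdd-forwardCount D C = isOdd-count (λ i → dir D (vx C i) (vx C (next i)))

  alongCycle-disagreement : ∀ D D′ (C : Cycle G) →
    alongCycle C (disagreement D D′) ≡ alongCycle C (dir D) xor alongCycle C (dir D′)
  alongCycle-disagreement D D′ C =
    ∑-distrib-+ (λ i → dir D (vx C i) (vx C (next i))) (λ i → dir D′ (vx C i) (vx C (next i)))

  ∑-forwardParities≡false : ∀ {k} (C : Fin k → Cycle G) → CoversEdgesEvenly C → (D D′ : Orientation G) →
    ∑[ c < k ] (isOdd (forwardCount D (C c)) xor isOdd (forwardCount D′ (C c))) ≡ false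
  ∑-forwardParities≡false C cover D D′ = trans
    (sum-cong-≗ λ c → trans (cong₂ _xor_ (isOdd-forwardCount D (C c)) (isOdd-forwardCount D′ (C c)))
                            (sym (alongCycle-disagreement D D′ (C c))))
    (∑-alongCycle≡false C cover (disagreement D D′) (disagreement-sym D D′) (disagreement⊆adj D D′))

lemma2p2 : {n : ℕ} (G : SimpleGraph n) (F : OneFactor G) (k : ℕ) (C : Fin k → Cycle G) →
    ZeroSumFSet F k C →
    (D : Orientation G) (k₁ : ℕ) → k₁ ≤ k →
    (∀ i → toℕ i < k₁ → OddlyOriented D (C i)) →
    (∀ i → toℕ i ≥ k₁ → EvenlyOriented D (C i)) →
    (Odd k₁ → ¬ (Σ (Orientation G) (λ D′ → EvenFOrientation F D′))) ×
    (Odd (k ∸ k₁) → ¬ (Σ (Orientation G) (λ D′ → OddFOrientation F D′)))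
lemma2p2 G F k C (alternating , evenCover) D k₁ k₁≤k odd-below even-above = noEven , noOdd
  where
  parity : Orientation G → Fin k → Bool
  parity D′ c = isOdd (forwardCount D′ (C c))

  differs-evenly : ∀ D′ β → (∀ c → parity D′ c ≡ β) → ∑[ c < k ] (parity D c xor β) ≡ false
  differs-evenly D′ β D′≡β = trans (sum-cong-≗ λ c → cong (parity D c xor_) (sym (D′≡β c)))
                                   (∑-forwardParities≡false C evenCover D D′)

  below : ∀ β c → toℕ c < k₁ → parity D c xor β ≡ not β
  below β c = cong (_xor β) ∘ Odd⇒isOdd≡true ∘ odd-below c

  above : ∀ β c → toℕ c ≥ k₁ → parity D c xor β ≡ β
  above β c = cong (_xor β) ∘ Even⇒isOdd≡false ∘ even-above c

  noEven : Odd k₁ → ¬ Σ (Orientation G) (EvenFOrientation F)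
  noEven k₁-odd (D′ , D′-even) = k₁-odd (isOdd≡false⇒Even k₁ (trans
    (sym (∑-trueBelow k₁≤k (λ c → parity D c xor false) (below false) (above false)))
    (differs-evenly D′ false λ c → Even⇒isOdd≡false (D′-even (C c) (alternating c)))))

  noOdd : Odd (k ∸ k₁) → ¬ Σ (Orientation G) (OddFOrientation F)
  noOdd k₂-odd (D′ , D′-odd) = k₂-odd (isOdd≡false⇒Even (k ∸ k₁) (trans
    (sym (∑-trueAbove k₁≤k (λ c → parity D c xor true) (below true) (above true)))
    (differs-evenly D′ true λ c → Odd⇒isOdd≡true (D′-odd (C c) (alternating c)))))
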